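{- Let $\Sigma$ be an $X$-symmetric graph with valency $\mathrm v\ge2$, let $1\le\kappa\le\mathrm v-1$, and let $\Theta$ be a self-paired $X$-symmetric orbit on $DSt^\kappa(\Sigma)$. Let $\Gamma=\Pi(\Sigma,\Theta)$, $\mathcal S=St(\Theta)$ and $\mathcal B=\{\mathcal S_\tau:\tau\in V(\Sigma)\}$, where $\mathcal S_\tau$ is the set of stars in $\mathcal S$ centred at $\tau$. Then $(\Gamma,X,\mathcal B)\in\mathcal G$, $\Gamma_{\mathcal B}\cong\Sigma$, and for $B=\mathcal S_\tau\in\mathcal B$ the incidence structure $\mathcal D(B)$ is isomorphic to the dual $\mathbb D^*(\tau)$ of $\mathbb D(\tau)$.
   Context: Graphs are finite, simple, undirected; $\Sigma(\tau)$ is the neighbourhood. $\Sigma$ is $X$-symmetric if $X$ acts on $V(\Sigma)$ preserving adjacency and transitively on vertices and on arcs (ordered pairs of adjacent vertices). Stars: for $S\subseteq\Sigma(\tau)$ with $|S|=\kappa$, the $\kappa$-star is $\mathfrak s(\tau,S)=\{(\tau,\sigma):\sigma\in S\}$ (centred at $\tau$). A star $\mathfrak s(\tau,S)$ is symmetric if $X_\tau\cap X_S$ is transitive on $S$; a set of stars is $X$-symmetric if it is a single $X$-orbit containing a symmetric star. A $\kappa$-double star is a pair $(\mathfrak l,\mathfrak r)$ of $\kappa$-stars $\mathfrak l=\mathfrak s(\tau,L)$, $\mathfrak r=\mathfrak s(\sigma,R)$ with $\sigma\in L$, $\tau\in R$; $DSt^\kappa(\Sigma)$ is the set of them. For $\Theta\subseteq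 DSt^\kappa(\Sigma)$, $St(\Theta)=\{\mathfrak l,\mathfrak r:(\mathfrak l,\mathfrak r)\in\Theta\}$; an $X$-orbit $\Theta$ is $X$-symmetric if $St(\Theta)$ is $X$-symmetric, and self-paired if $(\mathfrak l,\mathfrak r)\in\Theta$ implies $(\mathfrak r,\mathfrak l)\in\Theta$. $\Pi(\Sigma,\Theta)$ is the graph with vertex set $St(\Theta)$, $\mathfrak l\sim\mathfrak r$ iff $(\mathfrak l,\mathfrak r)\in\Theta$. $\mathbb D(\tau)$ is the incidence structure with point set $\Sigma(\tau)$, block set $\mathcal S_\tau$, with $\sigma$ incident with $\mathfrak s(\tau,S)$ iff $\sigma\in S$; its dual interchanges points and blocks. For an $X$-symmetric graph $\Gamma$ and $X$-invariant partition $\mathcal B$: $\Gamma_{\mathcal B}$ is the quotient graph on $\mathcal B$ ($B\sim C$ iff some vertex of $B$ is adjacent to some vertex of $C$); $\Gamma(C)=\bigcup_{\mathfrak u\in C}\Gamma(\mathfrak u)$; $\Gamma_{\mathcal B}(\mathfrak v)=\{C\in\mathcal B:\mathfrak v\in\Gamma(C)\}$; $\mathcal D(B)$ has point set $B$, block set the neighbourhood $\Gamma_{\mathcal B}(B)$ of $B$ in $\Gamma_{\mathcal B}$, with $\mathfrak v$ incident with $C$ iff $C\in\Gamma_{\mathcal B}(\mathfrak v)$. $\Gamma$ is a multicover of $\Gamma_{\mathcal B}$ if $|\Gamma(C)\cap B|=|B|$ for adjacent $B,C$. $\mathcal G$ is the set of triples $(\Gamma,X,\mathcal B)$ with $\Gamma$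 finite $X$-symmetric, $\mathcal B$ an $X$-invariant partition with $1<|B|<|V(\Gamma)|$, $val(\Gamma_{\mathcal B})\ge2$, and $\Gamma$ not a multicover of $\Gamma_{\mathcal B}$. -}

module Defs where

open import Level using (0ℓ)
open import Algebra.Bundles using (Group)
open import Data.Nat using (ℕ)
open import Data.Bool using (Bool; true; false)
open import Data.Fin using (Fin)
open import Data.Fin.Subset using (Subset; _∈_; _⊆_; ∣_∣)
open import Data.Vec using (tabulate; lookup)
open import Data.Product using (Σ; ∃; ∃-syntax; _×_; _,_; proj₁; proj₂)
open import Data.Sum using (_⊎_)
open import Relation.Nullary using (¬_)
open import Relation.Binary.PropositionalEquality using (_≡_)
open import Function.Base using (_∘_)

record Action (X : Group 0ℓ 0ℓ) (V : Set) : Set where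
  open Group X
  field
    act   : Carrier → V → V
    act-ε : ∀ v → act ε v ≡ v
    act-∙ : ∀ g h v → act (g ∙ h) v ≡ act g (act h v)
    act-≈ : ∀ {g h} → g ≈ h → ∀ v → act g v ≡ act h v

-- Generic notions for a graph Γ whose vertices are the elements of V
-- satisfying a predicate Vtx, with adjacency Adj, and an X-invariant
-- partition B given as an equivalence relation _~_ (blocks = classes).

module _ {V : Set} (Vtx : V → Set) (Adj : V → V → Set) (_~_ : V → V → Set) where

  -- adjacency in the quotient graph Γ_B (blocks represented by vertices)
  QAdj : V → V → Set
  QAdj b c = ¬ (b ~ c) × ∃[ x ] ∃[ y ] (Vtx x × Vtx y × x ~ b × y ~ c × Adj x y)

  -- Γ is a multicover of Γ_B: B ⊆ Γ(C) (i.e. |Γ(C) ∩ B| = |B|) for adjacent B, C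
  IsMulticover : Set
  IsMulticover = ∀ b c → Vtx b → Vtx c → QAdj b c →
    ∀ x → Vtx x → x ~ b → ∃[ y ] (Vtx y × y ~ c × Adj x y)

  QuotientIso : {n : ℕ} → (Fin n → Fin n → Bool) → Set
  QuotientIso {n} adj = Σ (V → Fin n) λ φ →
      ((∀ u v → Vtx u → Vtx v → (u ~ v → φ u ≡ φ v) × (φ u ≡ φ v → u ~ v))
    × (∀ (τ : Fin n) → ∃[ u ] (Vtx u × φ u ≡ τ))
    × (∀ u v → Vtx u → Vtx v →
         (QAdj u v → adj (φ u) (φ v) ≡ true) × (adj (φ u) (φ v) ≡ true → QAdj u v)))

module _ {X : Group 0ℓ 0ℓ} {V : Set} (act : Group.Carrier X → V → V)
         (Vtx : V → Set) (Adj : V → V → Set) where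

  IsXSymmetricGraph : Set
  IsXSymmetricGraph =
      (∀ g u → Vtx u → Vtx (act g u))
    × (∀ u v → Adj u v → Vtx u × Vtx v)
    × (∀ u v → Adj u v → Adj v u)
    × (∀ u → ¬ Adj u u)
    × (∀ g u v → Adj u v → Adj (act g u) (act g v))
    × (∀ u v → Vtx u → Vtx v → ∃[ g ] act g u ≡ v)
    × (∀ u v u′ v′ → Adj u v → Adj u′ v′ →
         ∃[ g ] (act g u ≡ u′ × act g v ≡ v′))

  module _ (_~_ : V → V → Set) where

    IsXInvariantPartition : Set
    IsXInvariantPartition =
        (∀ u → Vtx u → u ~ u)
      × (∀ u v → u ~ v → v ~ u)
      × (∀ u v w → u ~ v → v ~ w → u ~ w)
      × (∀ g u v → Vtx u → Vtx v → u ~ v → act g u ~ act g v)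

    InG : Set
    InG =
        IsXSymmetricGraph
      × IsXInvariantPartition
      × (∀ u → Vtx u → ∃[ u′ ] (Vtx u′ × u ~ u′ × ¬ (u′ ≡ u)))
      × (∀ u → Vtx u → ∃[ w ] (Vtx w × ¬ (u ~ w)))
      × (∀ b → Vtx b → ∃[ c₁ ] ∃[ c₂ ]
           (Vtx c₁ × Vtx c₂ × QAdj Vtx Adj _~_ b c₁ × QAdj Vtx Adj _~_ b c₂ × ¬ (c₁ ~ c₂)))
      × ¬ IsMulticover Vtx Adj _~_

record IncStr : Set₁ where
  field
    Pt  : Set
    _≈P_ : Pt → Pt → Set
    Bl  : Set
    _≈B_ : Bl → Bl → Set
    Inc : Pt → Bl → Set

dual : IncStr → IncStr
dual D = record { Pt = Bl ; _≈P_ = _≈B_ ; Bl = Pt ; _≈B_ = _≈P_ ; Inc = λ b p → Inc p b }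
  where open IncStr D

IncIso : IncStr → IncStr → Set
IncIso D E = Σ (D.Pt → E.Pt) λ fP → Σ (D.Bl → E.Bl) λ fB →
    (∀ p q → (p D.≈P q → fP p E.≈P fP q) × (fP p E.≈P fP q → p D.≈P q))
  × (∀ q → ∃[ p ] (fP p E.≈P q))
  × (∀ b c → (b D.≈B c → fB b E.≈B fB c) × (fB b E.≈B fB c → b D.≈B c))
  × (∀ c → ∃[ b ] (fB b E.≈B c))
  × (∀ p b → (D.Inc p b → E.Inc (fP p) (fB b)) × (E.Inc (fP p) (fB b) → D.Inc p b))
  where module D = IncStr D
        module E = IncStr E

-- 𝒟(B) for the block B containing vertex b (generic partition _~_)
module _ {V : Set} (Vtx : V → Set) (Adj : V → V → Set) (_~_ : V → V → Set) where
  𝒟 : V → IncStr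
  𝒟 b = record
    { Pt  = Σ V (λ x → Vtx x × x ~ b)
    ; _≈P_ = λ x y → proj₁ x ≡ proj₁ y
    ; Bl  = Σ V (λ c → Vtx c × QAdj Vtx Adj _~_ b c)
    ; _≈B_ = λ c d → proj₁ c ~ proj₁ d
    ; Inc = λ x c → ∃[ y ] (Vtx y × y ~ proj₁ c × Adj (proj₁ x) y)
    }

Star : ℕ → Set
Star n = Fin n × Subset n          -- 𝔰(τ,S) ↦ (τ , S)

centre : ∀ {n} → Star n → Fin n
centre = proj₁

DStar : ℕ → Set
DStar n = Star n × Star n

module _ {n : ℕ} (adj : Fin n → Fin n → Bool) where

  nbhd : Fin n → Subset n
  nbhd τ = tabulate (λ σ → adj τ σ)

  IsStar : ℕ → Star n → Set
  IsStar κ (τ , S) = S ⊆ nbhd τ × ∣ S ∣ ≡ κ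

  IsDStar : ℕ → DStar n → Set
  IsDStar κ ((τ , L) , (σ , R)) =
    IsStar κ (τ , L) × IsStar κ (σ , R) × σ ∈ L × τ ∈ R

  IsSimpleGraph : Set
  IsSimpleGraph = (∀ u v → adj u v ≡ adj v u) × (∀ u → adj u u ≡ false)

module _ {X : Group 0ℓ 0ℓ} {n : ℕ} (α : Action X (Fin n)) where
  open Group X using (Carrier; _⁻¹)
  open Action α using (act)

  -- induced action on subsets:  g·S = { g σ : σ ∈ S }
  actSub : Carrier → Subset n → Subset n
  actSub g S = tabulate (λ x → lookup S (act (g ⁻¹) x))

  actStar : Carrier → Star n → Star n
  actStar g (τ , S) = (act g τ , actSub g S)

  actDStar : Carrier → DStar n → DStar n
  actDStar g (l , r) = (actStar g l , actStar g r)

  IsXSymmetric : (Fin n → Fin n → Bool) → Set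
  IsXSymmetric adj =
      IsSimpleGraph adj
    × (∀ g u v → adj (act g u) (act g v) ≡ adj u v)
    × (∀ u v → ∃[ g ] act g u ≡ v)
    × (∀ u v u′ v′ → adj u v ≡ true → adj u′ v′ ≡ true →
         ∃[ g ] (act g u ≡ u′ × act g v ≡ v′))

  IsSymmetricStar : Star n → Set
  IsSymmetricStar (τ , S) = ∀ σ σ′ → σ ∈ S → σ′ ∈ S →
    ∃[ g ] (act g τ ≡ τ × actSub g S ≡ S × act g σ ≡ σ′)

  IsStarOrbit : (Star n → Set) → Set
  IsStarOrbit P = ∃[ s₀ ] (∀ s → (P s → ∃[ g ] s ≡ actStar g s₀) × (∃[ g ] s ≡ actStar g s₀ → P s))

  IsXSymmetricStars : (Star n → Set) → Set
  IsXSymmetricStars P = IsStarOrbit P × ∃[ s ] (P s × IsSymmetricStar s)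

  IsDStarOrbit : (DStar n → Set) → Set
  IsDStarOrbit Θ = ∃[ d₀ ] (∀ d → (Θ d → ∃[ g ] d ≡ actDStar g d₀) × (∃[ g ] d ≡ actDStar g d₀ → Θ d))

St : ∀ {n} → (DStar n → Set) → Star n → Set
St Θ s = (∃[ r ] Θ (s , r)) ⊎ (∃[ l ] Θ (l , s))

SelfPaired : ∀ {n} → (DStar n → Set) → Set
SelfPaired Θ = ∀ l r → Θ (l , r) → Θ (r , l)

-- Γ = Π(Σ,Θ): vertices St(Θ), 𝔩 ∼ 𝔯 iff (𝔩,𝔯) ∈ Θ
ΠAdj : ∀ {n} → (DStar n → Set) → Star n → Star n → Set
ΠAdj Θ l r = Θ (l , r)

-- B = { 𝒮_τ }: two stars are in the same block iff they have the same centre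
SameCentre : ∀ {n} → Star n → Star n → Set
SameCentre s t = centre s ≡ centre t

𝔻 : ∀ {n} → (Fin n → Fin n → Bool) → (DStar n → Set) → Fin n → IncStr
𝔻 {n} adj Θ τ = record
  { Pt  = Σ (Fin n) (λ σ → σ ∈ nbhd adj τ)
  ; _≈P_ = λ σ σ′ → proj₁ σ ≡ proj₁ σ′
  ; Bl  = Σ (Star n) (λ s → St Θ s × centre s ≡ τ)
  ; _≈B_ = λ s t → proj₁ s ≡ proj₁ t
  ; Inc = λ σ s → proj₁ σ ∈ proj₂ (proj₁ s)
  }

module Submission where

-- The proof is elementary bookkeeping organised around three general facts.
--   * Group actions: the action of X on Fin n induces actions on subsets,
--     stars and double stars, and in any single orbit of an action the
--     group acts transitively and the orbit is closed under the action.
--   * Symmetric stars: conjugating by g carries a symmetric star to a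
--     symmetric star, so in an X-symmetric set of stars every star is
--     symmetric (its stabiliser is transitive on its leaves).
--   * A subset of size κ < v of a v-element neighbourhood misses a
--     neighbour; by arc-transitivity of Σ this lets us move a star 𝔩 about
--     its centre so that its new leaf set avoids the centre of a partner 𝔯.
--     This single "avoiding move" gives both |B| ≥ 2 and "not a multicover".
-- Every arc of Σ is realised by the centres of a double star of Θ (Θ is
-- nonempty and Σ arc-transitive), which yields Γ_𝓑 ≅ Σ via the centre map.
-- Finally the incidence isomorphism 𝒟(B) ≅ 𝔻*(τ) is the identity on stars
-- and the centre map on blocks; incidence is matched using that the
-- stabiliser of a star is transitive on its leaves.

open import Defs
open import Level using (0ℓ)
open import Algebra.Bundles using (Group)
open import Data.Nat using (ℕ; _≤_; _<_; _∸_; s≤s)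
open import Data.Nat.Properties using (<-≤-trans; <-irrefl)
open import Data.Bool using (Bool; true)
open import Data.Fin using (Fin)
open import Data.Fin.Subset using (Subset; _∈_; _∉_; _⊆_; ∣_∣; ⁅_⁆)
open import Data.Fin.Subset.Properties using (_∈?_; p⊆q⇒∣p∣≤∣q∣; x∈⁅y⁆⇒x≡y; x∉⁅y⁆⇒x≢y; ∣⁅x⁆∣≡1)
open import Data.Fin.Properties using (any?)
open import Data.Vec using (lookup)
open import Data.Vec.Properties using (lookup∘tabulate; tabulate∘lookup; tabulate-cong; []=⇒lookup; lookup⇒[]=)
open import Data.Product using (Σ; ∃-syntax; _×_; _,_; proj₁; proj₂)
open import Data.Sum using (inj₁; inj₂)
open import Data.Empty using (⊥-elim)
open import Relation.Nullary using (¬_; yes; no; ¬?; _×-dec_)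
open import Relation.Binary.PropositionalEquality using (_≡_; refl; sym; trans; cong; cong₂; subst; subst₂)

missing-element : ∀ {n} (p q : Subset n) → p ⊆ q → ∣ p ∣ < ∣ q ∣ → ∃[ x ] (x ∈ q × x ∉ p)
missing-element p q p⊆q ∣p∣<∣q∣ with any? (λ x → (x ∈? q) ×-dec ¬? (x ∈? p))
... | yes found = found
... | no none = ⊥-elim (<-irrefl refl (<-≤-trans ∣p∣<∣q∣ (p⊆q⇒∣p∣≤∣q∣ q⊆p)))
  where
  q⊆p : q ⊆ p
  q⊆p {x} x∈q with x ∈? p
  ... | yes x∈p = x∈p
  ... | no x∉p = ⊥-elim (none (x , x∈q , x∉p))

module _ {X : Group 0ℓ 0ℓ} where
  open Group X using (Carrier; _∙_; _⁻¹; ε; inverseˡ; inverseʳ; ⁻¹-cong)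
  open import Algebra.Properties.Group X using (⁻¹-anti-homo-∙; ε⁻¹≈ε)

  module ActionInverse {A : Set} (β : Action X A) where
    open Action β

    act-inverseˡ : ∀ g x → act (g ⁻¹) (act g x) ≡ x
    act-inverseˡ g x = trans (sym (act-∙ (g ⁻¹) g x)) (trans (act-≈ (inverseˡ g) x) (act-ε x))

    act-inverseʳ : ∀ g x → act g (act (g ⁻¹) x) ≡ x
    act-inverseʳ g x = trans (sym (act-∙ g (g ⁻¹) x)) (trans (act-≈ (inverseʳ g) x) (act-ε x))

  _⊗_ : {A B : Set} → Action X A → Action X B → Action X (A × B)
  β ⊗ γ = record
    { act   = λ g xy → B.act g (proj₁ xy) , C.act g (proj₂ xy)
    ; act-ε = λ xy → cong₂ _,_ (B.act-ε (proj₁ xy)) (C.act-ε (proj₂ xy))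
    ; act-∙ = λ g h xy → cong₂ _,_ (B.act-∙ g h (proj₁ xy)) (C.act-∙ g h (proj₂ xy))
    ; act-≈ = λ g≈h xy → cong₂ _,_ (B.act-≈ g≈h (proj₁ xy)) (C.act-≈ g≈h (proj₂ xy))
    }
    where module B = Action β
          module C = Action γ

  module _ {n : ℕ} (α : Action X (Fin n)) where
    open Action α
    open ActionInverse α

    -- S ↦ g·S is an action on subsets, since (gh)⁻¹ = h⁻¹g⁻¹.
    subsetAction : Action X (Subset n)
    subsetAction = record
      { act   = actSub α
      ; act-ε = λ S → trans (tabulate-cong λ x → cong (lookup S) (trans (act-≈ ε⁻¹≈ε x) (act-ε x)))
                            (tabulate∘lookup S)
      ; act-∙ = λ g h S → tabulate-cong λ x →
                  trans (cong (lookup S) (trans (act-≈ (⁻¹-anti-homo-∙ g h) x) (act-∙ (h ⁻¹) (g ⁻¹) x)))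
                        (sym (lookup∘tabulate _ (act (g ⁻¹) x)))
      ; act-≈ = λ g≈h S → tabulate-cong λ x → cong (lookup S) (act-≈ (⁻¹-cong g≈h) x)
      }

    starAction : Action X (Star n)
    starAction = α ⊗ subsetAction

    dstarAction : Action X (DStar n)
    dstarAction = starAction ⊗ starAction

    ∈-actSub : ∀ g {x} {S : Subset n} → x ∈ S → act g x ∈ actSub α g S
    ∈-actSub g {x} {S} x∈S =
      lookup⇒[]= _ _ (trans (lookup∘tabulate _ (act g x)) (trans (cong (lookup S) (act-inverseˡ g x)) ([]=⇒lookup x∈S)))

    ∈-actSub⁻¹ : ∀ g {y} {S : Subset n} → y ∈ actSub α g S → act (g ⁻¹) y ∈ S
    ∈-actSub⁻¹ g {y} {S} y∈gS = lookup⇒[]= _ _ (trans (sym (lookup∘tabulate _ y)) ([]=⇒lookup y∈gS))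

  IsOrbit : {A : Set} → Action X A → (A → Set) → Set
  IsOrbit {A} β P = ∃[ x₀ ] (∀ x → (P x → ∃[ g ] x ≡ act g x₀) × (∃[ g ] x ≡ act g x₀ → P x))
    where open Action β

  module Orbit {A : Set} (β : Action X A) {P : A → Set} (orbit : IsOrbit β P) where
    open Action β
    open ActionInverse β

    base : A
    base = proj₁ orbit

    base∈ : P base
    base∈ = proj₂ (proj₂ orbit base) (ε , sym (act-ε base))

    closed : ∀ g {x} → P x → P (act g x)
    closed g {x} Px with proj₁ (proj₂ orbit x) Px
    ... | h , refl = proj₂ (proj₂ orbit (act g x)) (g ∙ h , sym (act-∙ g h base))

    transitive : ∀ {x y} → P x → P y → ∃[ g ] act g x ≡ y
    transitive {x} {y} Px Py with proj₁ (proj₂ orbit x) Px | proj₁ (proj₂ orbit y) Py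
    ... | a , refl | b , refl =
      b ∙ a ⁻¹ , trans (act-∙ b (a ⁻¹) (act a base)) (cong (act b) (act-inverseˡ a base))

  module _ {n : ℕ} (α : Action X (Fin n)) where
    open Action α
    open ActionInverse α
    open Action (starAction α) using () renaming (act-∙ to actStar-∙)
    open ActionInverse (starAction α) using () renaming (act-inverseˡ to actStar-inverseˡ)

    -- Conjugation: if k stabilises s and sends σ₀ ↦ σ₁, then g k g⁻¹
    -- stabilises g·s and sends g σ₀ ↦ g σ₁.  Hence symmetry is X-invariant.
    symmetric-actStar : ∀ g s → IsSymmetricStar α s → IsSymmetricStar α (actStar α g s)
    symmetric-actStar g s sym-s σ σ′ σ∈ σ′∈
      with sym-s (act (g ⁻¹) σ) (act (g ⁻¹) σ′) (∈-actSub⁻¹ α g σ∈) (∈-actSub⁻¹ α g σ′∈)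
    ... | k , kτ , kS , kσ = g ∙ (k ∙ g ⁻¹) , cong proj₁ fixes-gs , cong proj₂ fixes-gs , moves-σ
      where
      fixes-gs : actStar α (g ∙ (k ∙ g ⁻¹)) (actStar α g s) ≡ actStar α g s
      fixes-gs = trans (actStar-∙ g (k ∙ g ⁻¹) (actStar α g s))
                   (cong (actStar α g) (trans (actStar-∙ k (g ⁻¹) (actStar α g s))
                     (trans (cong (actStar α k) (actStar-inverseˡ g s)) (cong₂ _,_ kτ kS))))
      moves-σ : act (g ∙ (k ∙ g ⁻¹)) σ ≡ σ′
      moves-σ = trans (act-∙ g (k ∙ g ⁻¹) σ)
                  (trans (cong (act g) (trans (act-∙ k (g ⁻¹) σ) kσ)) (act-inverseʳ g σ′))

    all-symmetric : ∀ {P : Star n → Set} → IsXSymmetricStars α P → ∀ s → P s → IsSymmetricStar α s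
    all-symmetric (orbit , s₀ , Ps₀ , sym-s₀) s Ps with Orbit.transitive (starAction α) orbit Ps₀ Ps
    ... | g , refl = symmetric-actStar g s₀ sym-s₀

module _ {n : ℕ} (adj : Fin n → Fin n → Bool) where

  ∈nbhd⇒adj : ∀ {τ σ} → σ ∈ nbhd adj τ → adj τ σ ≡ true
  ∈nbhd⇒adj {τ} {σ} σ∈ = trans (sym (lookup∘tabulate (adj τ) σ)) ([]=⇒lookup σ∈)

  adj⇒∈nbhd : ∀ {τ σ} → adj τ σ ≡ true → σ ∈ nbhd adj τ
  adj⇒∈nbhd {τ} {σ} e = lookup⇒[]= σ _ (trans (lookup∘tabulate (adj τ) σ) e)

  adj⇒≢ : IsSimpleGraph adj → ∀ {τ σ} → adj τ σ ≡ true → ¬ (τ ≡ σ)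
  adj⇒≢ (_ , irreflexive) {τ} e refl with trans (sym e) (irreflexive τ)
  ... | ()

  another-neighbour : ∀ τ σ → 2 ≤ ∣ nbhd adj τ ∣ → σ ∈ nbhd adj τ →
                      ∃[ σ′ ] (σ′ ∈ nbhd adj τ × ¬ (σ′ ≡ σ))
  another-neighbour τ σ two≤val σ∈
    with missing-element ⁅ σ ⁆ (nbhd adj τ)
           (λ {x} x∈⁅σ⁆ → subst (_∈ nbhd adj τ) (sym (x∈⁅y⁆⇒x≡y σ x∈⁅σ⁆)) σ∈)
           (subst (_< ∣ nbhd adj τ ∣) (sym (∣⁅x⁆∣≡1 σ)) two≤val)
  ... | σ′ , σ′∈ , σ′∉⁅σ⁆ = σ′ , σ′∈ , x∉⁅y⁆⇒x≢y σ′∉⁅σ⁆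

-- The construction Γ = Π(Σ,Θ), under the hypotheses of Theorem 3.5
-- (with κ ≤ v - 1 in the form κ < v).
module PiConstruction
    (X : Group 0ℓ 0ℓ) (n : ℕ) (α : Action X (Fin n)) (adj : Fin n → Fin n → Bool)
    (Σ-symmetric : IsXSymmetric α adj)
    (v : ℕ) (valency : ∀ τ → ∣ nbhd adj τ ∣ ≡ v) (2≤v : 2 ≤ v)
    (κ : ℕ) (κ<v : κ < v)
    (Θ : DStar n → Set) (Θ-dstars : ∀ d → Θ d → IsDStar adj κ d) (Θ-orbit : IsDStarOrbit α Θ)
    (St-symmetric : IsXSymmetricStars α (St Θ)) (self-paired : SelfPaired Θ) where

  open Group X using (_⁻¹)
  open Action α
  open ActionInverse α using (act-inverseˡ)
  module ΘOrbit = Orbit (dstarAction α) Θ-orbit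
  module StOrbit = Orbit (starAction α) (proj₁ St-symmetric)

  simple : IsSimpleGraph adj
  simple = proj₁ Σ-symmetric

  vertex-transitive : ∀ u w → ∃[ g ] act g u ≡ w
  vertex-transitive = proj₁ (proj₂ (proj₂ Σ-symmetric))

  arc-transitive : ∀ u w u′ w′ → adj u w ≡ true → adj u′ w′ ≡ true →
                   ∃[ g ] (act g u ≡ u′ × act g w ≡ w′)
  arc-transitive = proj₂ (proj₂ (proj₂ Σ-symmetric))

  leaves : Star n → Subset n
  leaves = proj₂

  module _ {l r : Star n} (θ : Θ (l , r)) where
    partner-centre∈leaves : centre r ∈ leaves l
    partner-centre∈leaves = proj₁ (proj₂ (proj₂ (Θ-dstars (l , r) θ)))

    leaves⊆nbhd : leaves l ⊆ nbhd adj (centre l)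
    leaves⊆nbhd = proj₁ (proj₁ (Θ-dstars (l , r) θ))

    ∣leaves∣≡κ : ∣ leaves l ∣ ≡ κ
    ∣leaves∣≡κ = proj₂ (proj₁ (Θ-dstars (l , r) θ))

    centres-adjacent : adj (centre l) (centre r) ≡ true
    centres-adjacent = ∈nbhd⇒adj adj (leaves⊆nbhd partner-centre∈leaves)

    centres-distinct : ¬ (centre l ≡ centre r)
    centres-distinct = adj⇒≢ adj simple centres-adjacent

  partner : ∀ s → St Θ s → ∃[ r ] Θ (s , r)
  partner s (inj₁ found) = found
  partner s (inj₂ (l , θ)) = l , self-paired l s θ

  arc-realised : ∀ τ σ → adj τ σ ≡ true → ∃[ l ] ∃[ r ] (Θ (l , r) × centre l ≡ τ × centre r ≡ σ)
  arc-realised τ σ e with arc-transitive _ _ τ σ (centres-adjacent ΘOrbit.base∈) e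
  ... | g , gτ , gσ = actStar α g (proj₁ ΘOrbit.base) , actStar α g (proj₂ ΘOrbit.base) ,
                      ΘOrbit.closed g ΘOrbit.base∈ , gτ , gσ

  -- Avoiding move: as κ < v some neighbour of centre l is not a leaf of l;
  -- an element g fixing centre l and mapping centre r to that neighbour
  -- gives a star g·l with the same centre whose leaves miss centre r.
  avoiding-move : ∀ {l r} → Θ (l , r) →
                  ∃[ g ] (act g (centre l) ≡ centre l × centre r ∉ actSub α g (leaves l))
  avoiding-move {l} {r} θ
    with missing-element (leaves l) (nbhd adj (centre l)) (leaves⊆nbhd θ)
           (subst₂ _<_ (sym (∣leaves∣≡κ θ)) (sym (valency (centre l))) κ<v)
  ... | σ , σ∈nbhd , σ∉leaves
    with arc-transitive (centre l) σ (centre l) (centre r) (∈nbhd⇒adj adj σ∈nbhd) (centres-adjacent θ)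
  ... | g , g-fixes , gσ = g , g-fixes , λ r∈gl →
    σ∉leaves (subst (_∈ leaves l) (trans (cong (act (g ⁻¹)) (sym gσ)) (act-inverseˡ g σ))
                    (∈-actSub⁻¹ α g r∈gl))

  Vtx : Star n → Set
  Vtx = St Θ

  Adj : Star n → Star n → Set
  Adj = ΠAdj Θ

  _~_ : Star n → Star n → Set
  _~_ = SameCentre

  Γ_𝓑-adjacent : Star n → Star n → Set
  Γ_𝓑-adjacent = QAdj Vtx Adj _~_

  Θ⇒Γ_𝓑-adjacent : ∀ {l r} → Θ (l , r) → Γ_𝓑-adjacent l r
  Θ⇒Γ_𝓑-adjacent {l} {r} θ = centres-distinct θ , l , r , inj₁ (r , θ) , inj₂ (l , θ) , refl , refl , θ

  Γ_𝓑-adjacent⇒adj : ∀ u w → Γ_𝓑-adjacent u w → adj (centre u) (centre w) ≡ true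
  Γ_𝓑-adjacent⇒adj u w (_ , l , r , _ , _ , l~u , r~w , θ) =
    subst₂ (λ a b → adj a b ≡ true) l~u r~w (centres-adjacent θ)

  adj⇒Γ_𝓑-adjacent : ∀ u w → adj (centre u) (centre w) ≡ true → Γ_𝓑-adjacent u w
  adj⇒Γ_𝓑-adjacent u w e with arc-realised (centre u) (centre w) e
  ... | l , r , θ , l~u , r~w = adj⇒≢ adj simple e , l , r , inj₁ (r , θ) , inj₂ (l , θ) , l~u , r~w , θ

  -- Γ is an X-symmetric graph: arcs of Γ are the elements of the orbit Θ.
  Γ-symmetric : IsXSymmetricGraph {X = X} (actStar α) Vtx Adj
  Γ-symmetric =
      (λ g u → StOrbit.closed g)
    , (λ l r θ → inj₁ (r , θ) , inj₂ (l , θ))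
    , self-paired
    , (λ u θ → centres-distinct θ refl)
    , (λ g l r → ΘOrbit.closed g)
    , (λ u w → StOrbit.transitive)
    , (λ l r l′ r′ θ θ′ → let (g , e) = ΘOrbit.transitive θ θ′ in g , cong proj₁ e , cong proj₂ e)

  partition : IsXInvariantPartition {X = X} (actStar α) Vtx Adj _~_
  partition = (λ u _ → refl) , (λ u w → sym) , (λ u w z → trans) , (λ g u w _ _ e → cong (act g) e)

  -- |B| ≥ 2: the avoiding move gives a different star with the same centre.
  block-nontrivial : ∀ u → Vtx u → ∃[ u′ ] (Vtx u′ × u ~ u′ × ¬ (u′ ≡ u))
  block-nontrivial u Vu with partner u Vu
  ... | r , θ with avoiding-move θ
  ... | g , g-fixes , r∉gu = actStar α g u , StOrbit.closed g Vu , sym g-fixes ,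
        λ gu≡u → r∉gu (subst (λ s → centre r ∈ leaves s) (sym gu≡u) (partner-centre∈leaves θ))

  -- |B| < |V(Γ)|: a partner lies in another block.
  block-proper : ∀ u → Vtx u → ∃[ w ] (Vtx w × ¬ (u ~ w))
  block-proper u Vu with partner u Vu
  ... | r , θ = r , inj₂ (u , θ) , centres-distinct θ

  -- val(Γ_𝓑) ≥ 2: moving the double star along a second arc out of centre b.
  quotient-valency≥2 : ∀ b → Vtx b → ∃[ c₁ ] ∃[ c₂ ]
                       (Vtx c₁ × Vtx c₂ × Γ_𝓑-adjacent b c₁ × Γ_𝓑-adjacent b c₂ × ¬ (c₁ ~ c₂))
  quotient-valency≥2 b Vb with partner b Vb
  ... | r , θ with another-neighbour adj (centre b) (centre r) (subst (2 ≤_) (sym (valency (centre b))) 2≤v)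
                     (leaves⊆nbhd θ (partner-centre∈leaves θ))
  ... | σ , σ∈nbhd , σ≢r with arc-transitive (centre b) (centre r) (centre b) σ (centres-adjacent θ) (∈nbhd⇒adj adj σ∈nbhd)
  ... | g , g-fixes , gr≡σ =
    r , actStar α g r , inj₂ (b , θ) , inj₂ (actStar α g b , gθ) , Θ⇒Γ_𝓑-adjacent θ ,
    adj⇒Γ_𝓑-adjacent b (actStar α g r) (subst (λ a → adj a (act g (centre r)) ≡ true) g-fixes (centres-adjacent gθ)) ,
    λ r~gr → σ≢r (trans (sym gr≡σ) (sym r~gr))
    where gθ = ΘOrbit.closed g θ

  -- Not a multicover: for (𝔩,𝔯) ∈ Θ, the star g·𝔩 of the avoiding move lies
  -- in the block of 𝔩 but has no neighbour in the block of 𝔯.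
  multicover-fails-at : ∀ {l r} → Θ (l , r) → ¬ IsMulticover Vtx Adj _~_
  multicover-fails-at {l} {r} θ multicover with avoiding-move θ
  ... | g , g-fixes , r∉gl
    with multicover l r (inj₁ (r , θ)) (inj₂ (l , θ)) (Θ⇒Γ_𝓑-adjacent θ)
                    (actStar α g l) (StOrbit.closed g (inj₁ (r , θ))) g-fixes
  ... | y , _ , y~r , θ′ = r∉gl (subst (_∈ actSub α g (leaves l)) y~r (partner-centre∈leaves θ′))

  in-𝒢 : InG {X = X} (actStar α) (St Θ) (ΠAdj Θ) SameCentre
  in-𝒢 = Γ-symmetric , partition , block-nontrivial , block-proper , quotient-valency≥2 ,
         multicover-fails-at ΘOrbit.base∈

  quotient≅Σ : QuotientIso (St Θ) (ΠAdj Θ) SameCentre adj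
  quotient≅Σ = centre , (λ u w _ _ → (λ e → e) , (λ e → e)) , centre-surjective ,
               (λ u w _ _ → Γ_𝓑-adjacent⇒adj u w , adj⇒Γ_𝓑-adjacent u w)
    where
    centre-surjective : ∀ τ → ∃[ u ] (Vtx u × centre u ≡ τ)
    centre-surjective τ with vertex-transitive (centre StOrbit.base) τ
    ... | g , gτ = actStar α g StOrbit.base , StOrbit.closed g StOrbit.base∈ , gτ

  -- A star 𝔩 ∈ St Θ is Γ-adjacent to a star centred at σ iff σ is a leaf of
  -- 𝔩: move a partner of 𝔩 by the stabiliser of 𝔩 (transitive on leaves).
  adjacent-centre⇔leaf : ∀ l σ → Vtx l → (∃[ y ] (Vtx y × centre y ≡ σ × Θ (l , y)) → σ ∈ leaves l)
                                        × (σ ∈ leaves l → ∃[ y ] (Vtx y × centre y ≡ σ × Θ (l , y)))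
  adjacent-centre⇔leaf l σ Vl = to , from
    where
    to : ∃[ y ] (Vtx y × centre y ≡ σ × Θ (l , y)) → σ ∈ leaves l
    to (y , _ , yσ , θ) = subst (_∈ leaves l) yσ (partner-centre∈leaves θ)
    from : σ ∈ leaves l → ∃[ y ] (Vtx y × centre y ≡ σ × Θ (l , y))
    from σ∈ with partner l Vl
    ... | r , θ with all-symmetric α St-symmetric l Vl (centre r) σ (partner-centre∈leaves θ) σ∈
    ... | h , hτ , hS , hr≡σ = actStar α h r , inj₂ (l , hθ) , hr≡σ , hθ
      where hθ = subst (λ s → Θ (s , actStar α h r)) (cong₂ _,_ hτ hS) (ΘOrbit.closed h θ)

  -- 𝒟(B) ≅ 𝔻*(τ) for B = 𝒮_τ: points are the stars of B themselves, and a
  -- block C of 𝒟(B) corresponds to its centre, a neighbour of τ.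
  incidence≅dual : ∀ τ b → Vtx b → centre b ≡ τ → IncIso (𝒟 Vtx Adj _~_ b) (dual (𝔻 adj Θ τ))
  incidence≅dual τ b _ bτ =
      onPoints , onBlocks
    , (λ p q → (λ e → e) , (λ e → e))
    , (λ q → (proj₁ q , proj₁ (proj₂ q) , trans (proj₂ (proj₂ q)) (sym bτ)) , refl)
    , (λ c d → (λ e → e) , (λ e → e))
    , onBlocks-surjective
    , (λ p c → adjacent-centre⇔leaf (proj₁ p) (centre (proj₁ c)) (proj₁ (proj₂ p)))
    where
    onPoints : Σ (Star n) (λ x → Vtx x × x ~ b) → Σ (Star n) (λ s → Vtx s × centre s ≡ τ)
    onPoints (x , Vx , x~b) = x , Vx , trans x~b bτ
    onBlocks : Σ (Star n) (λ c → Vtx c × Γ_𝓑-adjacent b c) → Σ (Fin n) (λ σ → σ ∈ nbhd adj τ)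
    onBlocks (c , _ , bc) =
      centre c , adj⇒∈nbhd adj (subst (λ a → adj a (centre c) ≡ true) bτ (Γ_𝓑-adjacent⇒adj b c bc))
    onBlocks-surjective : ∀ (q : Σ (Fin n) (λ σ → σ ∈ nbhd adj τ)) → ∃[ c ] (proj₁ (onBlocks c) ≡ proj₁ q)
    onBlocks-surjective (σ , σ∈nbhd) with arc-realised τ σ (∈nbhd⇒adj adj σ∈nbhd)
    ... | l , r , θ , lτ , rσ =
      (r , inj₂ (l , θ) , adj⇒Γ_𝓑-adjacent b r (subst₂ (λ a c → adj a c ≡ true) (sym bτ) (sym rσ) (∈nbhd⇒adj adj σ∈nbhd))) , rσ

theorem3p5 : (X : Group 0ℓ 0ℓ) (n : ℕ) (α : Action X (Fin n)) (adj : Fin n → Fin n → Bool) →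
    IsXSymmetric α adj →
    (v : ℕ) → (∀ τ → ∣ nbhd adj τ ∣ ≡ v) → 2 ≤ v →
    (κ : ℕ) → 1 ≤ κ → κ ≤ v ∸ 1 →
    (Θ : DStar n → Set) →
    (∀ d → Θ d → IsDStar adj κ d) → IsDStarOrbit α Θ →
    IsXSymmetricStars α (St Θ) → SelfPaired Θ →
    InG {X = X} (actStar α) (St Θ) (ΠAdj Θ) SameCentre
    × QuotientIso (St Θ) (ΠAdj Θ) SameCentre adj
    × (∀ τ b → St Θ b → centre b ≡ τ →
    IncIso (𝒟 (St Θ) (ΠAdj Θ) SameCentre b) (dual (𝔻 adj Θ τ)))
theorem3p5 X n α adj Σ-symmetric v valency 2≤v@(s≤s _) κ _ κ≤v∸1 Θ Θ-dstars Θ-orbit St-symmetric self-paired =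
  in-𝒢 , quotient≅Σ , incidence≅dual
  where
  -- κ ≤ v ∸ 1 with v ≥ 1 is κ < v.
  open PiConstruction X n α adj Σ-symmetric v valency 2≤v κ (s≤s κ≤v∸1)
                      Θ Θ-dstars Θ-orbit St-symmetric self-paired
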